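{- Let $G$ be a simple graph, $v\in V(G)$, and let $G'$ be obtained from $G$ by adding a new vertex $\ell$ adjacent only to $v$. Assume \[ \operatorname{per}(L_G\circ L_G)\le \operatorname{per}(L_G)^2 \quad\text{and}\quad \operatorname{per}\bigl(L_G(v)\circ L_G(v)\bigr)\le \operatorname{per}\bigl(L_G(v)\bigr)^2. \] Then $\operatorname{per}(L_{G'}\circ L_{G'})\le \operatorname{per}(L_{G'})^2$.
   Context: $L_G=D_G-A_G$ is the graph Laplacian; $L_G(v)$ is the principal submatrix of $L_G$ obtained by deleting the row and column indexed by $v$. $\operatorname{per}$ is the permanent and $\circ$ the Hadamard (entrywise) product. -}

module Defs where

open import Data.Nat using (ℕ; zero; suc)
open import Data.Bool using (Bool; true; false; if_then_else_)
open import Data.Fin using (Fin; zero; suc; punchIn; _≟_)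
open import Data.Integer using (ℤ; +_; -_; _+_; _*_)
open import Relation.Binary.PropositionalEquality using (_≡_)
open import Relation.Nullary.Decidable using (⌊_⌋)

Matrix : ℕ → Set
Matrix n = Fin n → Fin n → ℤ

sumFin : ∀ {n} → (Fin n → ℤ) → ℤ
sumFin {zero}  f = + 0
sumFin {suc n} f = f zero + sumFin (λ i → f (suc i))

deleteRC : ∀ {n} → Fin (suc n) → Fin (suc n) → Matrix (suc n) → Matrix n
deleteRC i j M a b = M (punchIn i a) (punchIn j b)

principal : ∀ {n} → Fin (suc n) → Matrix (suc n) → Matrix n
principal v M = deleteRC v v M

-- Permanent, by (sign-free) Laplace expansion along the first row;
-- this is the standard recursive form of  per M = Σ_σ Π_i M i (σ i).
per : ∀ {n} → Matrix n → ℤ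
per {zero}  M = + 1
per {suc n} M = sumFin (λ j → M zero j * per (deleteRC zero j M))

_∘ₕ_ : ∀ {n} → Matrix n → Matrix n → Matrix n
(A ∘ₕ B) i j = A i j * B i j

record SimpleGraph (n : ℕ) : Set where
  field
    adj    : Fin n → Fin n → Bool
    sym    : ∀ i j → adj i j ≡ adj j i
    irrefl : ∀ i → adj i i ≡ false
open SimpleGraph public

b2ℤ : Bool → ℤ
b2ℤ true  = + 1
b2ℤ false = + 0

degree : ∀ {n} → SimpleGraph n → Fin n → ℤ
degree G i = sumFin (λ j → b2ℤ (adj G i j))

laplacian : ∀ {n} → SimpleGraph n → Matrix n
laplacian G i j = if ⌊ i ≟ j ⌋ then degree G i else - b2ℤ (adj G i j)

-- G' : add a new vertex (index zero) adjacent only to v; old vertex i becomes suc i.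
addPendantAdj : ∀ {n} → SimpleGraph n → Fin n → Fin (suc n) → Fin (suc n) → Bool
addPendantAdj G v zero    zero    = false
addPendantAdj G v zero    (suc j) = ⌊ j ≟ v ⌋
addPendantAdj G v (suc i) zero    = ⌊ i ≟ v ⌋
addPendantAdj G v (suc i) (suc j) = adj G i j

addPendant-sym : ∀ {n} (G : SimpleGraph n) (v : Fin n) i j →
  addPendantAdj G v i j ≡ addPendantAdj G v j i
addPendant-sym G v zero    zero    = _≡_.refl
addPendant-sym G v zero    (suc j) = _≡_.refl
addPendant-sym G v (suc i) zero    = _≡_.refl
addPendant-sym G v (suc i) (suc j) = sym G i j

addPendant-irrefl : ∀ {n} (G : SimpleGraph n) (v : Fin n) i →
  addPendantAdj G v i i ≡ false
addPendant-irrefl G v zero    = _≡_.refl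
addPendant-irrefl G v (suc i) = irrefl G i

addPendant : ∀ {n} → SimpleGraph n → Fin n → SimpleGraph (suc n)
addPendant G v = record
  { adj = addPendantAdj G v ; sym = addPendant-sym G v ; irrefl = addPendant-irrefl G v }

module Submission where

-- Expanding along the row of the pendant vertex ℓ gives, with d = deg v,
--   per L_G' = per L_G + 2 per L_G(v),
--   per (L_G' ∘ L_G') = per (L_G ∘ L_G) + (2 d + 2) per (L_G(v) ∘ L_G(v)):
-- deleting ℓ leaves L_G with its (v,v) entry raised by one, and in the minor of the entry
-- (ℓ, v) the column of ℓ has a single nonzero entry, with cofactor L_G(v).  Laplacians are
-- diagonally dominant, so per L_G and per L_G(v) are nonnegative; L_G ∘ L_G is entrywise
-- nonnegative, so d² per (L_G(v) ∘ L_G(v)) ≤ per (L_G ∘ L_G).  With the two hypotheses this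
-- gives d per (L_G(v) ∘ L_G(v)) ≤ per L_G per L_G(v), and the claim follows on expanding
-- (per L_G + 2 per L_G(v))².

open import Defs hiding (sym)
open import Data.Nat using (ℕ; zero; suc; z≤n)
import Data.Nat as ℕ
import Data.Nat.Properties as ℕₚ
open import Data.Bool using (true; false; if_then_else_)
open import Data.Fin using (Fin; zero; suc; punchIn; pinch; _≟_)
open import Data.Fin.Properties using (punchInᵢ≢i; suc-injective)
open import Data.Integer
  using (ℤ; +_; -[1+_]; 0ℤ; 1ℤ; -1ℤ; -_; _+_; _-_; _*_; _≤_; _<_; +≤+; ∣_∣; nonNegative; positive)
open import Data.Integer.Properties hiding (_≟_)
open import Data.Integer.Tactic.RingSolver using (solve-∀)
open import Algebra.Properties.Semiring.Sum +-*-semiring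
  using (sum; sum-cong-≗; sum-remove; sum-replicate-zero; ∑-distrib-+; ∑-comm; *-distribˡ-sum; *-distribʳ-sum)
open import Algebra.Properties.CommutativeSemigroup *-commutativeSemigroup using (x∙yz≈y∙xz)
open import Data.Product using (_×_; _,_; proj₁; proj₂)
open import Data.Sum using (inj₁; inj₂)
open import Data.Unit using (⊤; tt)
open import Data.Vec.Functional using (removeAt)
open import Function using (_∘_; flip)
open import Relation.Binary.PropositionalEquality
open import Relation.Nullary using (¬_; Dec; yes; no)
open import Relation.Nullary.Decidable using (⌊_⌋)

⌊≟⌋-refl : ∀ {n} (i : Fin n) → ⌊ i ≟ i ⌋ ≡ true
⌊≟⌋-refl i = cong ⌊_⌋ (≡-≟-identity _≟_ refl)

⌊≟⌋-≢ : ∀ {n} {i j : Fin n} → i ≢ j → ⌊ i ≟ j ⌋ ≡ false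
⌊≟⌋-≢ i≢j = cong ⌊_⌋ (≢-≟-identity _≟_ i≢j)

punchIn-pinch : ∀ {n} (r : Fin (suc (suc n))) (x : Fin (suc n)) →
  punchIn (punchIn r x) (pinch x r) ≡ r
punchIn-pinch zero    x       = refl
punchIn-pinch (suc r) zero    = refl
punchIn-pinch {suc n} (suc r) (suc x) = cong suc (punchIn-pinch r x)

punchIn-punchIn-pinch : ∀ {n} (r : Fin (suc (suc n))) (x : Fin (suc n)) (y : Fin n) →
  punchIn (punchIn r x) (punchIn (pinch x r) y) ≡ punchIn r (punchIn x y)
punchIn-punchIn-pinch zero    x       y       = refl
punchIn-punchIn-pinch (suc r) zero    y       = refl
punchIn-punchIn-pinch {suc n} (suc r) (suc x) zero    = refl
punchIn-punchIn-pinch {suc n} (suc r) (suc x) (suc y) = cong suc (punchIn-punchIn-pinch r x y)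

sumFin≡sum : ∀ {n} (f : Fin n → ℤ) → sumFin f ≡ sum f
sumFin≡sum {zero}  f = refl
sumFin≡sum {suc n} f = cong (_+_ (f zero)) (sumFin≡sum (f ∘ suc))

sumFin-cong : ∀ {n} {f g : Fin n → ℤ} → (∀ i → f i ≡ g i) → sumFin f ≡ sumFin g
sumFin-cong {f = f} {g} f≗g = trans (sumFin≡sum f) (trans (sum-cong-≗ f≗g) (sym (sumFin≡sum g)))

sumFin-remove : ∀ {n} (i : Fin (suc n)) (f : Fin (suc n) → ℤ) →
  sumFin f ≡ f i + sumFin (removeAt f i)
sumFin-remove i f =
  trans (sumFin≡sum f) (trans (sum-remove f) (cong (_+_ (f i)) (sym (sumFin≡sum (removeAt f i)))))

sumFin-removeAt-removeAt : ∀ {n} (r : Fin (suc (suc n))) (x : Fin (suc n)) →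
  (f : Fin (suc (suc n)) → ℤ) →
  sumFin (removeAt f (punchIn r x)) ≡ f r + sumFin (removeAt (removeAt f r) x)
sumFin-removeAt-removeAt r x f = trans (sumFin-remove (pinch x r) (removeAt f (punchIn r x)))
  (cong₂ _+_ (cong f (punchIn-pinch r x)) (sumFin-cong (cong f ∘ punchIn-punchIn-pinch r x)))

sumFin-distrib-+ : ∀ {n} (f g : Fin n → ℤ) → sumFin (λ i → f i + g i) ≡ sumFin f + sumFin g
sumFin-distrib-+ f g = trans (sumFin≡sum (λ i → f i + g i))
  (trans (∑-distrib-+ f g) (sym (cong₂ _+_ (sumFin≡sum f) (sumFin≡sum g))))

*-distribˡ-sumFin : ∀ {n} (c : ℤ) (f : Fin n → ℤ) → c * sumFin f ≡ sumFin (λ i → c * f i)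
*-distribˡ-sumFin c f = trans (cong (c *_) (sumFin≡sum f))
  (trans (*-distribˡ-sum c f) (sym (sumFin≡sum (λ i → c * f i))))

*-distribʳ-sumFin : ∀ {n} (c : ℤ) (f : Fin n → ℤ) → sumFin f * c ≡ sumFin (λ i → f i * c)
*-distribʳ-sumFin c f = trans (cong (_* c) (sumFin≡sum f))
  (trans (*-distribʳ-sum c f) (sym (sumFin≡sum (λ i → f i * c))))

sumFin-comm : ∀ {m n} (F : Fin m → Fin n → ℤ) →
  sumFin (λ i → sumFin (λ j → F i j)) ≡ sumFin (λ j → sumFin (λ i → F i j))
sumFin-comm F = begin
    sumFin (λ i → sumFin (F i))            ≡⟨ sumFin-cong (sumFin≡sum ∘ F) ⟩
    sumFin (λ i → sum (F i))               ≡⟨ sumFin≡sum (λ i → sum (F i)) ⟩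
    sum (λ i → sum (F i))                  ≡⟨ ∑-comm F ⟩
    sum (λ j → sum (λ i → F i j))          ≡⟨ sumFin≡sum (λ j → sum (λ i → F i j)) ⟨
    sumFin (λ j → sum (λ i → F i j))       ≡⟨ sumFin-cong (λ j → sumFin≡sum (flip F j)) ⟨
    sumFin (λ j → sumFin (λ i → F i j))    ∎
  where open ≡-Reasoning

sumFin-interchange : ∀ {m n} (x : Fin m → ℤ) (y : Fin n → ℤ) (F : Fin m → Fin n → ℤ) →
  sumFin (λ a → x a * sumFin (λ b → y b * F a b)) ≡ sumFin (λ b → y b * sumFin (λ a → x a * F a b))
sumFin-interchange x y F = begin
    sumFin (λ a → x a * sumFin (λ b → y b * F a b))
  ≡⟨ sumFin-cong (λ a → *-distribˡ-sumFin (x a) (λ b → y b * F a b)) ⟩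
    sumFin (λ a → sumFin (λ b → x a * (y b * F a b)))
  ≡⟨ sumFin-cong (λ a → sumFin-cong (λ b → x∙yz≈y∙xz (x a) (y b) (F a b))) ⟩
    sumFin (λ a → sumFin (λ b → y b * (x a * F a b)))
  ≡⟨ sumFin-comm (λ a b → y b * (x a * F a b)) ⟩
    sumFin (λ b → sumFin (λ a → y b * (x a * F a b)))
  ≡⟨ sumFin-cong (λ b → *-distribˡ-sumFin (y b) (λ a → x a * F a b)) ⟨
    sumFin (λ b → y b * sumFin (λ a → x a * F a b))
  ∎
  where open ≡-Reasoning

sumFin-neg : ∀ {n} (f : Fin n → ℤ) → sumFin (λ i → - f i) ≡ - sumFin f
sumFin-neg {zero}  f = refl
sumFin-neg {suc n} f =
  trans (cong (_+_ (- f zero)) (sumFin-neg (f ∘ suc))) (sym (neg-distrib-+ (f zero) _))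

sumFin-zero : ∀ {n} {f : Fin n → ℤ} → (∀ i → f i ≡ 0ℤ) → sumFin f ≡ 0ℤ
sumFin-zero {n} f≗0 =
  trans (sumFin-cong f≗0) (trans (sumFin≡sum {n} (λ _ → 0ℤ)) (sum-replicate-zero n))

sumFin-single : ∀ {n} (i : Fin (suc n)) {f : Fin (suc n) → ℤ} → (∀ j → j ≢ i → f j ≡ 0ℤ) →
  sumFin f ≡ f i
sumFin-single i {f} f≡0 = trans (sumFin-remove i f) (trans
  (cong (_+_ (f i)) (sumFin-zero (λ k → f≡0 (punchIn i k) (punchInᵢ≢i i k))))
  (+-identityʳ (f i)))

sumFin-mono : ∀ {n} {f g : Fin n → ℤ} → (∀ i → f i ≤ g i) → sumFin f ≤ sumFin g
sumFin-mono {zero}  f≤g = ≤-refl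
sumFin-mono {suc n} f≤g = +-mono-≤ (f≤g zero) (sumFin-mono (f≤g ∘ suc))

sumFin-nonneg : ∀ {n} {f : Fin n → ℤ} → (∀ i → 0ℤ ≤ f i) → 0ℤ ≤ sumFin f
sumFin-nonneg {zero}  f≥0 = ≤-refl
sumFin-nonneg {suc n} f≥0 = +-mono-≤ (f≥0 zero) (sumFin-nonneg (f≥0 ∘ suc))

*-nonneg : ∀ {i j : ℤ} → 0ℤ ≤ i → 0ℤ ≤ j → 0ℤ ≤ i * j
*-nonneg {+ m} {+ n} _ _ = subst (0ℤ ≤_) (pos-* m n) (+≤+ z≤n)

square-nonneg : ∀ i → 0ℤ ≤ i * i
square-nonneg (+ n)    = *-nonneg {+ n} {+ n} (+≤+ z≤n) (+≤+ z≤n)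
square-nonneg -[1+ n ] = +≤+ z≤n

-∣i∣≤i : ∀ i → - + ∣ i ∣ ≤ i
-∣i∣≤i (+ n)    = neg-≤-pos
-∣i∣≤i -[1+ n ] = ≤-refl

0≤p±x⇒∣x∣≤p : ∀ {x p} → 0ℤ ≤ p + x → 0ℤ ≤ p - x → + ∣ x ∣ ≤ p
0≤p±x⇒∣x∣≤p {x} {p} 0≤p+x 0≤p-x with +∣i∣≡i⊎+∣i∣≡-i x
... | inj₁ ∣x∣≡x  = subst (_≤ p) (sym ∣x∣≡x) (0≤i-j⇒j≤i 0≤p-x)
... | inj₂ ∣x∣≡-x = subst (_≤ p) (sym ∣x∣≡-x)
  (0≤i-j⇒j≤i (subst (λ y → 0ℤ ≤ p + y) (sym (neg-involutive x)) 0≤p+x))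

∣x∣≤p⇒-∣a∣*p≤a*x : ∀ a {x p} → + ∣ x ∣ ≤ p → - (+ ∣ a ∣ * p) ≤ a * x
∣x∣≤p⇒-∣a∣*p≤a*x a {x} {p} ∣x∣≤p = begin
    - (+ ∣ a ∣ * p)          ≤⟨ neg-mono-≤ (*-monoˡ-≤-nonNeg (+ ∣ a ∣) ∣x∣≤p) ⟩
    - (+ ∣ a ∣ * + ∣ x ∣)    ≡⟨ cong -_ (trans (cong +_ (∣i*j∣≡∣i∣*∣j∣ a x)) (pos-* ∣ a ∣ ∣ x ∣)) ⟨
    - + ∣ a * x ∣            ≤⟨ -∣i∣≤i (a * x) ⟩
    a * x                    ∎
  where open ≤-Reasoning

x*x≤y*y⇒x≤y : ∀ {x y} → 0ℤ ≤ y → x * x ≤ y * y → x ≤ y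
x*x≤y*y⇒x≤y {x} {y} 0≤y x*x≤y*y = ≮⇒≥ (λ y<x → <⇒≱ (y*y<x*x y<x) x*x≤y*y)
  where
  y*y<x*x : y < x → y * y < x * x
  y*y<x*x y<x = ≤-<-trans (*-monoʳ-≤-nonNeg y {{nonNegative 0≤y}} (<⇒≤ y<x))
                          (*-monoˡ-<-pos x {{positive (≤-<-trans 0≤y y<x)}} y<x)

per-cong : ∀ {n} {M N : Matrix n} → (∀ i j → M i j ≡ N i j) → per M ≡ per N
per-cong {zero}  M≗N = refl
per-cong {suc n} M≗N =
  sumFin-cong (λ j → cong₂ _*_ (M≗N zero j) (per-cong (λ x y → M≗N (suc x) (punchIn j y))))

per-expand-col₀ : ∀ {n} (M : Matrix (suc n)) →
  per M ≡ sumFin (λ i → M i zero * per (deleteRC i zero M))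
per-expand-col₀ {zero}  M = refl
per-expand-col₀ {suc n} M = cong (_+_ (M zero zero * per (deleteRC zero zero M))) (begin
    sumFin (λ k → M zero (suc k) * per (deleteRC zero (suc k) M))
  ≡⟨ sumFin-cong (λ k → cong (M zero (suc k) *_) (per-expand-col₀ (deleteRC zero (suc k) M))) ⟩
    sumFin (λ k → M zero (suc k) * sumFin (λ a → M (suc a) zero * per (minor a k)))
  ≡⟨ sumFin-interchange (λ k → M zero (suc k)) (λ a → M (suc a) zero) (λ k a → per (minor a k)) ⟩
    sumFin (λ a → M (suc a) zero * sumFin (λ k → M zero (suc k) * per (minor a k)))
  ∎)
  where
  open ≡-Reasoning
  minor : Fin (suc n) → Fin (suc n) → Matrix n
  minor a k x y = M (suc (punchIn a x)) (suc (punchIn k y))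

per-expand-row : ∀ {n} (M : Matrix (suc n)) (r : Fin (suc n)) →
  per M ≡ sumFin (λ j → M r j * per (deleteRC r j M))
per-expand-row {zero}  M zero = refl
per-expand-row {suc n} M r = begin
    per M
  ≡⟨ per-expand-col₀ M ⟩
    sumFin (λ i → M i zero * per (deleteRC i zero M))
  ≡⟨ sumFin-remove r (λ i → M i zero * per (deleteRC i zero M)) ⟩
    M r zero * per (deleteRC r zero M)
      + sumFin (λ a → M (punchIn r a) zero * per (deleteRC (punchIn r a) zero M))
  ≡⟨ cong (_+_ (M r zero * per (deleteRC r zero M))) other-rows ⟩
    sumFin (λ j → M r j * per (deleteRC r j M))
  ∎
  where
  open ≡-Reasoning
  minor : Fin (suc n) → Fin (suc n) → Matrix n
  minor a b x y = M (punchIn r (punchIn a x)) (suc (punchIn b y))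
  expand-minor : ∀ a →
    per (deleteRC (punchIn r a) zero M) ≡ sumFin (λ b → M r (suc b) * per (minor a b))
  expand-minor a = trans (per-expand-row (deleteRC (punchIn r a) zero M) (pinch a r))
    (sumFin-cong λ b → cong₂ _*_
      (cong (λ i → M i (suc b)) (punchIn-pinch r a))
      (per-cong λ x y → cong (λ i → M i (suc (punchIn b y))) (punchIn-punchIn-pinch r a x)))
  other-rows : sumFin (λ a → M (punchIn r a) zero * per (deleteRC (punchIn r a) zero M))
             ≡ sumFin (λ b → M r (suc b) * per (deleteRC r (suc b) M))
  other-rows = begin
      sumFin (λ a → M (punchIn r a) zero * per (deleteRC (punchIn r a) zero M))
    ≡⟨ sumFin-cong (λ a → cong (M (punchIn r a) zero *_) (expand-minor a)) ⟩
      sumFin (λ a → M (punchIn r a) zero * sumFin (λ b → M r (suc b) * per (minor a b)))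
    ≡⟨ sumFin-interchange (λ a → M (punchIn r a) zero) (λ b → M r (suc b)) (λ a → per ∘ minor a) ⟩
      sumFin (λ b → M r (suc b) * sumFin (λ a → M (punchIn r a) zero * per (minor a b)))
    ≡⟨ sumFin-cong (λ b → cong (M r (suc b) *_) (per-expand-col₀ (deleteRC r (suc b) M))) ⟨
      sumFin (λ b → M r (suc b) * per (deleteRC r (suc b) M))
    ∎

per-transpose : ∀ {n} (M : Matrix n) → per (flip M) ≡ per M
per-transpose {zero}  M = refl
per-transpose {suc n} M = trans
  (sumFin-cong (λ j → cong (M j zero *_) (per-transpose (deleteRC j zero M))))
  (sym (per-expand-col₀ M))

per-expand-col : ∀ {n} (M : Matrix (suc n)) (c : Fin (suc n)) →
  per M ≡ sumFin (λ i → M i c * per (deleteRC i c M))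
per-expand-col M c = begin
    per M
  ≡⟨ per-transpose M ⟨
    per (flip M)
  ≡⟨ per-expand-row (flip M) c ⟩
    sumFin (λ i → M i c * per (flip (deleteRC i c M)))
  ≡⟨ sumFin-cong (λ i → cong (M i c *_) (per-transpose (deleteRC i c M))) ⟩
    sumFin (λ i → M i c * per (deleteRC i c M))
  ∎
  where open ≡-Reasoning

per-expand-row-diagonal : ∀ {n} (M : Matrix (suc n)) (r : Fin (suc n)) →
  per M ≡ M r r * per (principal r M)
            + sumFin (λ k → M r (punchIn r k) * per (deleteRC r (punchIn r k) M))
per-expand-row-diagonal M r =
  trans (per-expand-row M r) (sumFin-remove r (λ j → M r j * per (deleteRC r j M)))

per-bump-diagonal : ∀ {n} (M N : Matrix (suc n)) (r : Fin (suc n)) (c : ℤ) →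
  (∀ i j → ¬ (i ≡ r × j ≡ r) → N i j ≡ M i j) → N r r ≡ M r r + c →
  per N ≡ per M + c * per (principal r M)
per-bump-diagonal M N r c N≡M Nrr≡Mrr+c = begin
    per N
  ≡⟨ per-expand-row-diagonal N r ⟩
    N r r * per (principal r N) + sumFin (λ k → N r (punchIn r k) * per (deleteRC r (punchIn r k) N))
  ≡⟨ cong₂ _+_ (cong₂ _*_ Nrr≡Mrr+c (same-minor r)) (sumFin-cong (λ k →
       cong₂ _*_ (N≡M r _ (punchInᵢ≢i r k ∘ proj₂)) (same-minor (punchIn r k)))) ⟩
    (M r r + c) * K + S
  ≡⟨ regroup (M r r) c K S ⟩
    (M r r * K + S) + c * K
  ≡⟨ cong (_+ c * K) (per-expand-row-diagonal M r) ⟨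
    per M + c * K
  ∎
  where
  open ≡-Reasoning
  K : ℤ
  K = per (principal r M)
  S : ℤ
  S = sumFin (λ k → M r (punchIn r k) * per (deleteRC r (punchIn r k) M))
  same-minor : ∀ j → per (deleteRC r j N) ≡ per (deleteRC r j M)
  same-minor j = per-cong (λ x y → N≡M _ _ (punchInᵢ≢i r x ∘ proj₁))
  regroup : ∀ m c K S → (m + c) * K + S ≡ (m * K + S) + c * K
  regroup = solve-∀

per-expand-col₀-single : ∀ {n} (Q : Matrix (suc n)) (v : Fin (suc n)) →
  (∀ i → i ≢ v → Q i zero ≡ 0ℤ) → per Q ≡ Q v zero * per (deleteRC v zero Q)
per-expand-col₀-single Q v Q≡0 = trans (per-expand-col₀ Q) (sumFin-single v (λ i i≢v →
  trans (cong (_* per (deleteRC i zero Q)) (Q≡0 i i≢v)) (*-zeroˡ (per (deleteRC i zero Q)))))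

single : ∀ {n} → Fin n → ℤ → Fin n → ℤ
single k w j = if ⌊ j ≟ k ⌋ then w else 0ℤ

single-same : ∀ {n} (k : Fin n) (w : ℤ) → single k w k ≡ w
single-same k w = cong (if_then w else 0ℤ) (⌊≟⌋-refl k)

single-other : ∀ {n} {j k : Fin n} (w : ℤ) → j ≢ k → single k w j ≡ 0ℤ
single-other w j≢k = cong (if_then w else 0ℤ) (⌊≟⌋-≢ j≢k)

addToColumn : ∀ {n} → Fin n → (Fin n → ℤ) → Matrix n → Matrix n
addToColumn k u N i j = N i j + single k (u i) j

per-addToColumn : ∀ {n} (k : Fin (suc n)) (u : Fin (suc n) → ℤ) (N : Matrix (suc n)) →
  per (addToColumn k u N) ≡ per N + sumFin (λ a → u a * per (deleteRC a k N))
per-addToColumn {n} k u N = begin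
    per (addToColumn k u N)
  ≡⟨ per-expand-col (addToColumn k u N) k ⟩
    sumFin (λ a → (N a k + single k (u a) k) * per (deleteRC a k (addToColumn k u N)))
  ≡⟨ sumFin-cong (λ a → cong₂ _*_ (cong (_+_ (N a k)) (single-same k (u a))) (same-minor a)) ⟩
    sumFin (λ a → (N a k + u a) * K a)
  ≡⟨ sumFin-cong (λ a → *-distribʳ-+ (K a) (N a k) (u a)) ⟩
    sumFin (λ a → N a k * K a + u a * K a)
  ≡⟨ sumFin-distrib-+ (λ a → N a k * K a) (λ a → u a * K a) ⟩
    sumFin (λ a → N a k * K a) + sumFin (λ a → u a * K a)
  ≡⟨ cong (_+ sumFin (λ a → u a * K a)) (per-expand-col N k) ⟨
    per N + sumFin (λ a → u a * K a)
  ∎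
  where
  open ≡-Reasoning
  K : Fin (suc n) → ℤ
  K a = per (deleteRC a k N)
  same-minor : ∀ a → per (deleteRC a k (addToColumn k u N)) ≡ K a
  same-minor a = per-cong (λ x y →
    trans (cong (_+_ (N _ _)) (single-other _ (punchInᵢ≢i k y))) (+-identityʳ _))

per-nonneg : ∀ {n} (M : Matrix n) → (∀ i j → 0ℤ ≤ M i j) → 0ℤ ≤ per M
per-nonneg {zero}  M M≥0 = +≤+ z≤n
per-nonneg {suc n} M M≥0 = sumFin-nonneg (λ j →
  *-nonneg (M≥0 zero j) (per-nonneg (deleteRC zero j M) (λ x y → M≥0 (suc x) (punchIn j y))))

diagonal-term≤per : ∀ {n} (M : Matrix (suc n)) (r : Fin (suc n)) → (∀ i j → 0ℤ ≤ M i j) →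
  M r r * per (principal r M) ≤ per M
diagonal-term≤per M r M≥0 = begin
    M r r * per (principal r M)
  ≤⟨ i≤i+j _ S {{nonNegative S≥0}} ⟩
    M r r * per (principal r M) + S
  ≡⟨ per-expand-row-diagonal M r ⟨
    per M
  ∎
  where
  open ≤-Reasoning
  S : ℤ
  S = sumFin (λ k → M r (punchIn r k) * per (deleteRC r (punchIn r k) M))
  S≥0 : 0ℤ ≤ S
  S≥0 = sumFin-nonneg (λ k → *-nonneg (M≥0 r _)
    (per-nonneg (deleteRC r (punchIn r k) M) (λ x y → M≥0 _ _)))

absSum : ∀ {n} → (Fin n → ℤ) → ℤ
absSum r = sumFin (λ j → + ∣ r j ∣)

absSum-+ : ∀ {n} (r e : Fin n → ℤ) → absSum (λ j → r j + e j) ≤ absSum r + absSum e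
absSum-+ r e = ≤-trans (sumFin-mono (λ j → +≤+ (∣i+j∣≤∣i∣+∣j∣ (r j) (e j))))
                       (≤-reflexive (sumFin-distrib-+ (λ j → + ∣ r j ∣) (λ j → + ∣ e j ∣)))

absSum-single : ∀ {n} (k : Fin (suc n)) (w : ℤ) → absSum (single k w) ≡ + ∣ w ∣
absSum-single k w = trans (sumFin-single k (λ j j≢k → cong (+_ ∘ ∣_∣) (single-other w j≢k)))
                          (cong (+_ ∘ ∣_∣) (single-same k w))

DiagDominant : ∀ {n} → Matrix n → Set
DiagDominant {zero}  M = ⊤
DiagDominant {suc n} M = ∀ i → absSum (removeAt (M i) i) ≤ M i i

dominant-row-+ : ∀ {n} (i : Fin (suc n)) (r e : Fin (suc n) → ℤ) →
  absSum e + absSum (removeAt r i) ≤ r i →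
  absSum (removeAt (λ j → r j + e j) i) ≤ r i + e i
dominant-row-+ i r e hyp = begin
    absSum (removeAt (λ j → r j + e j) i)
  ≤⟨ absSum-+ (removeAt r i) (removeAt e i) ⟩
    absSum (removeAt r i) + absSum (removeAt e i)
  ≡⟨ add-then-cancel (+ ∣ e i ∣) (absSum (removeAt e i)) (absSum (removeAt r i)) ⟩
    (+ ∣ e i ∣ + absSum (removeAt e i) + absSum (removeAt r i)) - + ∣ e i ∣
  ≡⟨ cong (λ s → (s + absSum (removeAt r i)) - + ∣ e i ∣) (sumFin-remove i (λ j → + ∣ e j ∣)) ⟨
    (absSum e + absSum (removeAt r i)) - + ∣ e i ∣
  ≤⟨ +-monoˡ-≤ (- + ∣ e i ∣) hyp ⟩
    r i - + ∣ e i ∣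
  ≤⟨ +-monoʳ-≤ (r i) (-∣i∣≤i (e i)) ⟩
    r i + e i
  ∎
  where
  open ≤-Reasoning
  add-then-cancel : ∀ a b c → c + b ≡ (a + b + c) - a
  add-then-cancel = solve-∀

principal-dominant : ∀ {n} (M : Matrix (suc n)) (r : Fin (suc n)) →
  DiagDominant M → DiagDominant (principal r M)
principal-dominant {zero}  M r dom   = tt
principal-dominant {suc n} M r dom x = begin
    absSum (removeAt (principal r M x) x)
  ≤⟨ i≤j+i _ (+ ∣ M p r ∣) ⟩
    + ∣ M p r ∣ + absSum (removeAt (principal r M x) x)
  ≡⟨ sumFin-removeAt-removeAt r x (λ j → + ∣ M p j ∣) ⟨
    absSum (removeAt (M p) p)
  ≤⟨ dom p ⟩
    M p p
  ∎
  where
  open ≤-Reasoning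
  p : Fin (suc (suc n))
  p = punchIn r x

addToColumn-dominant : ∀ {n} (M : Matrix (suc (suc n))) (k : Fin (suc n)) (t : ℤ) →
  ∣ t ∣ ≡ 1 → DiagDominant M →
  DiagDominant (addToColumn k (λ i → t * M (suc i) zero) (principal zero M))
addToColumn-dominant M k t ∣t∣≡1 dom x =
  dominant-row-+ x (principal zero M x) (single k (t * M (suc x) zero)) (begin
      absSum (single k (t * M (suc x) zero)) + absSum (removeAt (principal zero M x) x)
    ≡⟨ cong (_+ absSum (removeAt (principal zero M x) x))
            (trans (absSum-single k (t * M (suc x) zero)) ∣tc∣≡∣c∣) ⟩
      absSum (removeAt (M (suc x)) (suc x))
    ≤⟨ dom (suc x) ⟩
      M (suc x) (suc x)
    ∎)
  where
  open ≤-Reasoning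
  ∣tc∣≡∣c∣ : + ∣ t * M (suc x) zero ∣ ≡ + ∣ M (suc x) zero ∣
  ∣tc∣≡∣c∣ = cong +_ (trans (∣i*j∣≡∣i∣*∣j∣ t (M (suc x) zero))
    (trans (cong (ℕ._* ∣ M (suc x) zero ∣) ∣t∣≡1) (ℕₚ.*-identityˡ ∣ M (suc x) zero ∣)))

-- With N the leading principal submatrix and c the first column below the corner,
-- per (N ± c eₖᵀ) = p ± X for X the minor of the entry (0, k+1); both matrices are still
-- dominant, so nonnegativity in size n gives |X| ≤ p.
first-row-minor-bound : ∀ {n} (M : Matrix (suc n)) →
  (∀ (N : Matrix n) → DiagDominant N → 0ℤ ≤ per N) → DiagDominant M →
  ∀ k → + ∣ per (deleteRC zero (suc k) M) ∣ ≤ per (principal zero M)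
first-row-minor-bound {suc n} M per≥0 dom k = 0≤p±x⇒∣x∣≤p
  (subst (λ y → 0ℤ ≤ p + y) (*-identityˡ X) (0≤p+t*X 1ℤ refl))
  (subst (λ y → 0ℤ ≤ p + y) (-1*i≡-i X) (0≤p+t*X -1ℤ refl))
  where
  N : Matrix (suc n)
  N = principal zero M
  p : ℤ
  p = per N
  X : ℤ
  X = per (deleteRC zero (suc k) M)
  per-shifted : ∀ t → per (addToColumn k (λ i → t * M (suc i) zero) N) ≡ p + t * X
  per-shifted t = begin
      per (addToColumn k (λ i → t * M (suc i) zero) N)
    ≡⟨ per-addToColumn k (λ i → t * M (suc i) zero) N ⟩
      p + sumFin (λ a → t * M (suc a) zero * per (deleteRC a k N))
    ≡⟨ cong (_+_ p) (sumFin-cong (λ a → *-assoc t (M (suc a) zero) (per (deleteRC a k N)))) ⟩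
      p + sumFin (λ a → t * (M (suc a) zero * per (deleteRC a k N)))
    ≡⟨ cong (_+_ p) (*-distribˡ-sumFin t (λ a → M (suc a) zero * per (deleteRC a k N))) ⟨
      p + t * sumFin (λ a → M (suc a) zero * per (deleteRC a k N))
    ≡⟨ cong (λ s → p + t * s) (per-expand-col₀ (deleteRC zero (suc k) M)) ⟨
      p + t * X
    ∎
    where open ≡-Reasoning
  0≤p+t*X : ∀ t → ∣ t ∣ ≡ 1 → 0ℤ ≤ p + t * X
  0≤p+t*X t ∣t∣≡1 = subst (0ℤ ≤_) (per-shifted t) (per≥0
    (addToColumn k (λ i → t * M (suc i) zero) N) (addToColumn-dominant M k t ∣t∣≡1 dom))

per-nonneg-dominant : ∀ {n} (M : Matrix n) → DiagDominant M → 0ℤ ≤ per M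
per-nonneg-dominant {zero}  M dom = +≤+ z≤n
per-nonneg-dominant {suc n} M dom = begin
    0ℤ
  ≤⟨ *-nonneg (i≤j⇒0≤j-i (dom zero)) 0≤p ⟩
    (M zero zero - A) * p
  ≡⟨ *-distribʳ-+ p (M zero zero) (- A) ⟩
    M zero zero * p + - A * p
  ≡⟨ cong (_+_ (M zero zero * p)) -A*p≡ ⟩
    M zero zero * p + sumFin (λ k → - (+ ∣ M zero (suc k) ∣ * p))
  ≤⟨ +-monoʳ-≤ (M zero zero * p) (sumFin-mono (λ k → ∣x∣≤p⇒-∣a∣*p≤a*x (M zero (suc k))
       (first-row-minor-bound M (per-nonneg-dominant {n}) dom k))) ⟩
    per M
  ∎
  where
  open ≤-Reasoning
  p : ℤ
  p = per (principal zero M)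
  A : ℤ
  A = absSum (removeAt (M zero) zero)
  0≤p : 0ℤ ≤ p
  0≤p = per-nonneg-dominant (principal zero M) (principal-dominant M zero dom)
  -A*p≡ : - A * p ≡ sumFin (λ k → - (+ ∣ M zero (suc k) ∣ * p))
  -A*p≡ = begin-equality
      - A * p
    ≡⟨ neg-distribˡ-* A p ⟨
      - (A * p)
    ≡⟨ cong -_ (*-distribʳ-sumFin p (λ k → + ∣ M zero (suc k) ∣)) ⟩
      - sumFin (λ k → + ∣ M zero (suc k) ∣ * p)
    ≡⟨ sumFin-neg (λ k → + ∣ M zero (suc k) ∣ * p) ⟨
      sumFin (λ k → - (+ ∣ M zero (suc k) ∣ * p))
    ∎

laplacian-diag : ∀ {n} (G : SimpleGraph n) (i : Fin n) → laplacian G i i ≡ degree G i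
laplacian-diag G i = cong (if_then degree G i else - b2ℤ (adj G i i)) (⌊≟⌋-refl i)

laplacian-off : ∀ {n} (G : SimpleGraph n) {i j : Fin n} → i ≢ j → laplacian G i j ≡ - b2ℤ (adj G i j)
laplacian-off G {i} {j} i≢j = cong (if_then degree G i else - b2ℤ (adj G i j)) (⌊≟⌋-≢ i≢j)

∣-b2ℤ∣ : ∀ b → + ∣ - b2ℤ b ∣ ≡ b2ℤ b
∣-b2ℤ∣ true  = refl
∣-b2ℤ∣ false = refl

laplacian-dominant : ∀ {n} (G : SimpleGraph (suc n)) → DiagDominant (laplacian G)
laplacian-dominant G i = ≤-reflexive (begin
    absSum (removeAt (laplacian G i) i)
  ≡⟨ sumFin-cong (λ k → trans (cong (+_ ∘ ∣_∣) (laplacian-off G (punchInᵢ≢i i k ∘ sym))) (∣-b2ℤ∣ _)) ⟩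
    sumFin (removeAt (b2ℤ ∘ adj G i) i)
  ≡⟨ +-identityˡ _ ⟨
    b2ℤ false + sumFin (removeAt (b2ℤ ∘ adj G i) i)
  ≡⟨ cong (λ b → b2ℤ b + sumFin (removeAt (b2ℤ ∘ adj G i) i)) (irrefl G i) ⟨
    b2ℤ (adj G i i) + sumFin (removeAt (b2ℤ ∘ adj G i) i)
  ≡⟨ sumFin-remove i (b2ℤ ∘ adj G i) ⟨
    degree G i
  ≡⟨ laplacian-diag G i ⟨
    laplacian G i i
  ∎)
  where open ≡-Reasoning

record PendantBlock {n} (P : Matrix (suc (suc n))) (M : Matrix (suc n)) (v : Fin (suc n)) (c : ℤ)
       : Set where
  field
    row₀-zero : ∀ j → j ≢ v → P zero (suc j) ≡ 0ℤ
    col₀-zero : ∀ i → i ≢ v → P (suc i) zero ≡ 0ℤ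
    block     : ∀ i j → ¬ (i ≡ v × j ≡ v) → P (suc i) (suc j) ≡ M i j
    block-vv  : P (suc v) (suc v) ≡ M v v + c
open PendantBlock

per-pendantBlock : ∀ {n} {P : Matrix (suc (suc n))} {M : Matrix (suc n)} {v : Fin (suc n)} {c : ℤ} →
  PendantBlock P M v c →
  per P ≡ P zero zero * (per M + c * per (principal v M))
          + P zero (suc v) * (P (suc v) zero * per (principal v M))
per-pendantBlock {P = P} {M} {v} {c} pb =
  cong₂ _+_ (cong (P zero zero *_) (per-bump-diagonal M (principal zero P) v c (block pb) (block-vv pb)))
            (trans (sumFin-single v first-row-zero) (cong (P zero (suc v) *_) pendant-minor))
  where
  first-row-zero : ∀ j → j ≢ v → P zero (suc j) * per (deleteRC zero (suc j) P) ≡ 0ℤ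
  first-row-zero j j≢v =
    trans (cong (_* per (deleteRC zero (suc j) P)) (row₀-zero pb j j≢v))
          (*-zeroˡ (per (deleteRC zero (suc j) P)))
  pendant-minor : per (deleteRC zero (suc v) P) ≡ P (suc v) zero * per (principal v M)
  pendant-minor = trans (per-expand-col₀-single (deleteRC zero (suc v) P) v (col₀-zero pb))
    (cong (P (suc v) zero *_) (per-cong (λ x y → block pb _ _ (punchInᵢ≢i v x ∘ proj₁))))

pendantBlock-∘ₕ : ∀ {n} {P : Matrix (suc (suc n))} {M : Matrix (suc n)} {v : Fin (suc n)} {c : ℤ} →
  PendantBlock P M v c → PendantBlock (P ∘ₕ P) (M ∘ₕ M) v (c * (+ 2 * M v v + c))
row₀-zero (pendantBlock-∘ₕ pb) j j≢v = cong₂ _*_ (row₀-zero pb j j≢v) (row₀-zero pb j j≢v)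
col₀-zero (pendantBlock-∘ₕ pb) i i≢v = cong₂ _*_ (col₀-zero pb i i≢v) (col₀-zero pb i i≢v)
block     (pendantBlock-∘ₕ pb) i j ¬vv = cong₂ _*_ (block pb i j ¬vv) (block pb i j ¬vv)
block-vv  (pendantBlock-∘ₕ {M = M} {v} {c} pb) =
  trans (cong₂ _*_ (block-vv pb) (block-vv pb)) (square-shift (M v v) c)
  where
  square-shift : ∀ m c → (m + c) * (m + c) ≡ m * m + c * (+ 2 * m + c)
  square-shift = solve-∀

laplacian-addPendant-block : ∀ {n} (G : SimpleGraph (suc n)) (v : Fin (suc n)) (i j : Fin (suc n)) →
  ¬ (i ≡ v × j ≡ v) → Dec (i ≡ j) → laplacian (addPendant G v) (suc i) (suc j) ≡ laplacian G i j
laplacian-addPendant-block G v i .i ¬vv (yes refl) = begin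
    laplacian (addPendant G v) (suc i) (suc i)   ≡⟨ laplacian-diag (addPendant G v) (suc i) ⟩
    b2ℤ ⌊ i ≟ v ⌋ + degree G i                   ≡⟨ cong (λ b → b2ℤ b + degree G i) (⌊≟⌋-≢ i≢v) ⟩
    0ℤ + degree G i                              ≡⟨ +-identityˡ (degree G i) ⟩
    degree G i                                   ≡⟨ laplacian-diag G i ⟨
    laplacian G i i                              ∎
  where
  open ≡-Reasoning
  i≢v : i ≢ v
  i≢v i≡v = ¬vv (i≡v , i≡v)
laplacian-addPendant-block G v i j ¬vv (no i≢j) =
  trans (laplacian-off (addPendant G v) (i≢j ∘ suc-injective)) (sym (laplacian-off G i≢j))

laplacian-addPendant : ∀ {n} (G : SimpleGraph (suc n)) (v : Fin (suc n)) →
  PendantBlock (laplacian (addPendant G v)) (laplacian G) v 1ℤ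
row₀-zero (laplacian-addPendant G v) j j≢v   = cong (-_ ∘ b2ℤ) (⌊≟⌋-≢ j≢v)
col₀-zero (laplacian-addPendant G v) i i≢v   = cong (-_ ∘ b2ℤ) (⌊≟⌋-≢ i≢v)
block     (laplacian-addPendant G v) i j ¬vv = laplacian-addPendant-block G v i j ¬vv (i ≟ j)
block-vv  (laplacian-addPendant G v) = begin
    laplacian (addPendant G v) (suc v) (suc v)   ≡⟨ laplacian-diag (addPendant G v) (suc v) ⟩
    b2ℤ ⌊ v ≟ v ⌋ + degree G v                   ≡⟨ cong (λ b → b2ℤ b + degree G v) (⌊≟⌋-refl v) ⟩
    1ℤ + degree G v                              ≡⟨ +-comm 1ℤ (degree G v) ⟩
    degree G v + 1ℤ                              ≡⟨ cong (_+ 1ℤ) (laplacian-diag G v) ⟨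
    laplacian G v v + 1ℤ                         ∎
  where open ≡-Reasoning

laplacian-addPendant-00 : ∀ {n} (G : SimpleGraph (suc n)) (v : Fin (suc n)) →
  laplacian (addPendant G v) zero zero ≡ 1ℤ
laplacian-addPendant-00 G v = begin
    laplacian (addPendant G v) zero zero      ≡⟨ laplacian-diag (addPendant G v) zero ⟩
    0ℤ + sumFin (λ j → b2ℤ ⌊ j ≟ v ⌋)          ≡⟨ +-identityˡ _ ⟩
    sumFin (λ j → b2ℤ ⌊ j ≟ v ⌋)               ≡⟨ sumFin-single v (λ j j≢v → cong b2ℤ (⌊≟⌋-≢ j≢v)) ⟩
    b2ℤ ⌊ v ≟ v ⌋                              ≡⟨ cong b2ℤ (⌊≟⌋-refl v) ⟩
    1ℤ                                         ∎
  where open ≡-Reasoning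

laplacian-addPendant-0v : ∀ {n} (G : SimpleGraph (suc n)) (v : Fin (suc n)) →
  laplacian (addPendant G v) zero (suc v) ≡ -1ℤ
laplacian-addPendant-0v G v = cong (-_ ∘ b2ℤ) (⌊≟⌋-refl v)

laplacian-addPendant-v0 : ∀ {n} (G : SimpleGraph (suc n)) (v : Fin (suc n)) →
  laplacian (addPendant G v) (suc v) zero ≡ -1ℤ
laplacian-addPendant-v0 G v = cong (-_ ∘ b2ℤ) (⌊≟⌋-refl v)

per-laplacian-addPendant : ∀ {n} (G : SimpleGraph (suc n)) (v : Fin (suc n)) →
  per (laplacian (addPendant G v)) ≡ per (laplacian G) + + 2 * per (principal v (laplacian G))
per-laplacian-addPendant {n} G v = begin
    per L′
  ≡⟨ per-pendantBlock (laplacian-addPendant G v) ⟩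
    L′ zero zero * (a + 1ℤ * b) + L′ zero (suc v) * (L′ (suc v) zero * b)
  ≡⟨ cong₂ _+_ (cong (_* (a + 1ℤ * b)) (laplacian-addPendant-00 G v)) (cong₂ (λ x y → x * (y * b))
       (laplacian-addPendant-0v G v) (laplacian-addPendant-v0 G v)) ⟩
    1ℤ * (a + 1ℤ * b) + -1ℤ * (-1ℤ * b)
  ≡⟨ collect a b ⟩
    a + + 2 * b
  ∎
  where
  open ≡-Reasoning
  L′ : Matrix (suc (suc n))
  L′ = laplacian (addPendant G v)
  a : ℤ
  a = per (laplacian G)
  b : ℤ
  b = per (principal v (laplacian G))
  collect : ∀ a b → 1ℤ * (a + 1ℤ * b) + -1ℤ * (-1ℤ * b) ≡ a + + 2 * b
  collect = solve-∀

per-laplacian²-addPendant : ∀ {n} (G : SimpleGraph (suc n)) (v : Fin (suc n)) →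
  let L = laplacian G ; Lᵥ = principal v (laplacian G) ; L′ = laplacian (addPendant G v) in
  per (L′ ∘ₕ L′) ≡ per (L ∘ₕ L) + (+ 2 * L v v + 1ℤ) * per (Lᵥ ∘ₕ Lᵥ) + per (Lᵥ ∘ₕ Lᵥ)
per-laplacian²-addPendant {n} G v = begin
    per (L′ ∘ₕ L′)
  ≡⟨ per-pendantBlock (pendantBlock-∘ₕ (laplacian-addPendant G v)) ⟩
    L′ zero zero * L′ zero zero * (q + 1ℤ * (+ 2 * d + 1ℤ) * h)
      + L′ zero (suc v) * L′ zero (suc v) * (L′ (suc v) zero * L′ (suc v) zero * h)
  ≡⟨ cong₂ _+_ (cong (λ x → x * x * (q + 1ℤ * (+ 2 * d + 1ℤ) * h)) (laplacian-addPendant-00 G v))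
       (cong₂ (λ x y → x * x * (y * y * h)) (laplacian-addPendant-0v G v) (laplacian-addPendant-v0 G v)) ⟩
    1ℤ * 1ℤ * (q + 1ℤ * (+ 2 * d + 1ℤ) * h) + -1ℤ * -1ℤ * (-1ℤ * -1ℤ * h)
  ≡⟨ collect q d h ⟩
    q + (+ 2 * d + 1ℤ) * h + h
  ∎
  where
  open ≡-Reasoning
  L′ : Matrix (suc (suc n))
  L′ = laplacian (addPendant G v)
  q : ℤ
  q = per (laplacian G ∘ₕ laplacian G)
  d : ℤ
  d = laplacian G v v
  h : ℤ
  h = per (principal v (laplacian G) ∘ₕ principal v (laplacian G))
  collect : ∀ q d h → 1ℤ * 1ℤ * (q + 1ℤ * (+ 2 * d + 1ℤ) * h) + -1ℤ * -1ℤ * (-1ℤ * -1ℤ * h)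
                    ≡ q + (+ 2 * d + 1ℤ) * h + h
  collect = solve-∀

pendant-square-inequality : ∀ {a b d h q : ℤ} → 0ℤ ≤ a → 0ℤ ≤ b → 0ℤ ≤ h →
  d * d * h ≤ q → q ≤ a * a → h ≤ b * b →
  q + (+ 2 * d + 1ℤ) * h + h ≤ (a + + 2 * b) * (a + + 2 * b)
pendant-square-inequality {a} {b} {d} {h} {q} 0≤a 0≤b 0≤h d*d*h≤q q≤a*a h≤b*b = begin
    q + (+ 2 * d + 1ℤ) * h + h
  ≡⟨ expand-left q d h ⟩
    q + + 2 * (d * h) + + 2 * h
  ≤⟨ +-mono-≤ (+-mono-≤ q≤a*a (*-monoˡ-≤-nonNeg (+ 2) d*h≤a*b)) (*-monoˡ-≤-nonNeg (+ 2) h≤b*b) ⟩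
    a * a + + 2 * (a * b) + + 2 * (b * b)
  ≤⟨ i≤i+j _ (+ 2 * b * (a + b)) {{nonNegative 0≤2b[a+b]}} ⟩
    a * a + + 2 * (a * b) + + 2 * (b * b) + + 2 * b * (a + b)
  ≡⟨ expand-right a b ⟩
    (a + + 2 * b) * (a + + 2 * b)
  ∎
  where
  open ≤-Reasoning
  expand-left : ∀ q d h → q + (+ 2 * d + 1ℤ) * h + h ≡ q + + 2 * (d * h) + + 2 * h
  expand-left = solve-∀
  expand-right : ∀ a b → a * a + + 2 * (a * b) + + 2 * (b * b) + + 2 * b * (a + b)
                       ≡ (a + + 2 * b) * (a + + 2 * b)
  expand-right = solve-∀
  regroup : ∀ d h → d * h * (d * h) ≡ d * d * h * h
  regroup = solve-∀
  regroup′ : ∀ a b → a * a * (b * b) ≡ a * b * (a * b)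
  regroup′ = solve-∀
  0≤2b[a+b] : 0ℤ ≤ + 2 * b * (a + b)
  0≤2b[a+b] = *-nonneg (*-nonneg {+ 2} (+≤+ z≤n) 0≤b) (+-mono-≤ 0≤a 0≤b)
  d*h≤a*b : d * h ≤ a * b
  d*h≤a*b = x*x≤y*y⇒x≤y (*-nonneg 0≤a 0≤b) (begin
      d * h * (d * h)    ≡⟨ regroup d h ⟩
      d * d * h * h      ≤⟨ *-monoʳ-≤-nonNeg h {{nonNegative 0≤h}} (≤-trans d*d*h≤q q≤a*a) ⟩
      a * a * h          ≤⟨ *-monoˡ-≤-nonNeg (a * a) {{nonNegative (square-nonneg a)}} h≤b*b ⟩
      a * a * (b * b)    ≡⟨ regroup′ a b ⟩
      a * b * (a * b)    ∎)

corollary4p2 : ∀ {n : ℕ} (G : SimpleGraph (suc n)) (v : Fin (suc n)) →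
    per (laplacian G ∘ₕ laplacian G) ≤ per (laplacian G) * per (laplacian G) →
    per (principal v (laplacian G) ∘ₕ principal v (laplacian G))
      ≤ per (principal v (laplacian G)) * per (principal v (laplacian G)) →
    per (laplacian (addPendant G v) ∘ₕ laplacian (addPendant G v))
      ≤ per (laplacian (addPendant G v)) * per (laplacian (addPendant G v))
corollary4p2 {n} G v per[L∘L]≤per[L]² per[Lᵥ∘Lᵥ]≤per[Lᵥ]² = begin
    per (L′ ∘ₕ L′)
  ≡⟨ per-laplacian²-addPendant G v ⟩
    per (L ∘ₕ L) + (+ 2 * L v v + 1ℤ) * per (Lᵥ ∘ₕ Lᵥ) + per (Lᵥ ∘ₕ Lᵥ)
  ≤⟨ pendant-square-inequality {d = L v v}
       (per-nonneg-dominant L (laplacian-dominant G))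
       (per-nonneg-dominant Lᵥ (principal-dominant L v (laplacian-dominant G)))
       (per-nonneg (Lᵥ ∘ₕ Lᵥ) (λ i j → square-nonneg (Lᵥ i j)))
       (diagonal-term≤per (L ∘ₕ L) v (λ i j → square-nonneg (L i j)))
       per[L∘L]≤per[L]² per[Lᵥ∘Lᵥ]≤per[Lᵥ]² ⟩
    (per L + + 2 * per Lᵥ) * (per L + + 2 * per Lᵥ)
  ≡⟨ cong (λ x → x * x) (per-laplacian-addPendant G v) ⟨
    per L′ * per L′
  ∎
  where
  open ≤-Reasoning
  L : Matrix (suc n)
  L = laplacian G
  Lᵥ : Matrix n
  Lᵥ = principal v L
  L′ : Matrix (suc (suc n))
  L′ = laplacian (addPendant G v)
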